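{- The proof system $\mathcal{M}$ is not complete, even for numerically explicit sets of premises: there exist a numerically explicit finite set $\Phi$ of $\mathcal{N}^{1+}$-formulas and an $\mathcal{N}^{1+}$-formula $\phi$ such that $\Phi \models \phi$ but $\Phi \not\vdash_{\mathcal{M}} \phi$.
   Context: We work in first-order logic with counting quantifiers $\exists_{\leq C}$, $\exists_{\geq C}$ with the obvious semantics; $\models$ denotes semantic entailment. A literal $L$ is a formula $p(x)$ or $\neg p(x)$ with $p$ a unary predicate; $\bar{L}$ denotes its opposite ($\neg p(x)$, resp. $p(x)$). $\mathcal{N}^{1+}$ is the set of formulas $\exists_{\geq C} x (L_1 \wedge L_2)$ and $\exists_{\leq C} x (L_1 \wedge L_2)$ with $L_1, L_2$ literals and $C \geq 0$. In the proof system, $\exists_{\bowtie C} x(L_1 \wedge L_2)$ and $\exists_{\bowtie C} x(L_2 \wedge L_1)$ are identified, and negative subscripts are allowed: for $C<0$, $\exists_{\leq C} x(L_1\wedge L_2)$ is false and $\exists_{\geq C} x(L_1\wedge L_2)$ is true. The natural deduction system $\mathcal{M}$ has: (i) axiom schemas $\exists_{\geq 0} x (L_1 \wedge L_2)$ and $\exists_{\leq C} x (L \wedge \bar{L})$ for all $C \geq 0$; (ii) rules of inference: from $\exists_{\leq C} x (L_1 \wedge L_2)$ and $\exists_{\leq D} x (\bar{L}_2 \wedge L_3)$ infer $\exists_{\leq C+D} x (L_1 \wedge L_3)$; from $\exists_{\geq C} x (L_1 \wedge L_2)$ and $\exists_{\leq D} x (L_2 \wedge L_3)$ infer $\exists_{\geq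 C-D} x (L_1 \wedge \bar{L}_3)$; from $\exists_{\leq C} x (L_1 \wedge L_1)$ and $\exists_{\geq D} x (L_1 \wedge L_2)$ infer $\exists_{\leq C-D} x (L_1 \wedge \bar{L}_2)$; (iii) ex falso quodlibet: if from premises $\Phi$ one has derived $\exists_{\leq C} x (L_1 \wedge L_2)$ and $\exists_{\geq D} x (L_1 \wedge L_2)$ with $D > C$, then any formula may be derived from $\Phi$. $\Phi \vdash_{\mathcal{M}} \phi$ means there is a deduction in $\mathcal{M}$ from premises $\Phi$ to $\phi$. A set $\Phi$ of $\mathcal{N}^{1+}$-formulas, with predicates $p_1,\ldots,p_n$, is numerically explicit if there are natural numbers $C > 0$ and $C_1,\ldots,C_n \leq C$ such that for each $i$, $\Phi$ contains $\exists_{\leq C_i} x (p_i(x) \wedge p_i(x))$, $\exists_{\geq C_i} x (p_i(x) \wedge p_i(x))$, $\exists_{\leq C - C_i} x (\neg p_i(x) \wedge \neg p_i(x))$ and $\exists_{\geq C - C_i} x (\neg p_i(x) \wedge \neg p_i(x))$. -}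

module Defs where

open import Data.Nat using (ℕ; suc; _≤_; _>_)
open import Data.Integer using (ℤ; +_; _-_; _<_) renaming (_+_ to _+ℤ_)
open import Data.Bool using (Bool; true; false; not; _∧_)
open import Data.Fin using (Fin)
open import Data.List using (List)
open import Data.List.Membership.Propositional using (_∈_)
open import Data.Product using (Σ; _×_)
open import Relation.Binary.PropositionalEquality using (_≡_)
open import Relation.Nullary using (¬_)
open import Function.Definitions using (Injective)

Pred : Set
Pred = ℕ

data Lit : Set where
  pos : Pred → Lit
  neg : Pred → Lit

opp : Lit → Lit
opp (pos p) = neg p
opp (neg p) = pos p

-- Formulas ∃_{≥C} x (L₁ ∧ L₂) and ∃_{≤C} x (L₁ ∧ L₂), with subscripts in N.
data Form (N : Set) : Set where
  atLeast : N → Lit → Lit → Form N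
  atMost  : N → Lit → Lit → Form N

N1 : Set
N1 = Form ℕ

-- Formulas manipulated in the proof system M: integer subscripts allowed.
ZForm : Set
ZForm = Form ℤ

embed : N1 → ZForm
embed (atLeast C L₁ L₂) = atLeast (+ C) L₁ L₂
embed (atMost  C L₁ L₂) = atMost  (+ C) L₁ L₂

Interp : Set → Set
Interp A = Pred → A → Bool

litVal : {A : Set} → Interp A → Lit → A → Bool
litVal I (pos p) a = I p a
litVal I (neg p) a = not (I p a)

conjHolds : {A : Set} → Interp A → Lit → Lit → A → Set
conjHolds I L₁ L₂ a = (litVal I L₁ a ∧ litVal I L₂ a) ≡ true

Sat : {A : Set} → Interp A → N1 → Set
Sat {A} I (atLeast C L₁ L₂) =
  Σ (Fin C → A) λ f → Injective _≡_ _≡_ f × (∀ i → conjHolds I L₁ L₂ (f i))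
Sat {A} I (atMost C L₁ L₂) =
  (f : Fin (suc C) → A) → Injective _≡_ _≡_ f → ¬ (∀ i → conjHolds I L₁ L₂ (f i))

_⊨_ : List N1 → N1 → Set₁
Φ ⊨ φ = (A : Set) (I : Interp A) → (∀ {ψ} → ψ ∈ Φ → Sat I ψ) → Sat I φ

data Der (Φ : List N1) : ZForm → Set where
  premise : ∀ {φ} → φ ∈ Φ → Der Φ (embed φ)
  ax≥0    : ∀ L₁ L₂ → Der Φ (atLeast (+ 0) L₁ L₂)
  ax≤opp  : ∀ (C : ℕ) L → Der Φ (atMost (+ C) L (opp L))
  -- identification of (L₁ ∧ L₂) with (L₂ ∧ L₁)
  swap≥   : ∀ {C L₁ L₂} → Der Φ (atLeast C L₁ L₂) → Der Φ (atLeast C L₂ L₁)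
  swap≤   : ∀ {C L₁ L₂} → Der Φ (atMost C L₁ L₂) → Der Φ (atMost C L₂ L₁)
  rule1   : ∀ {C D L₁ L₂ L₃} → Der Φ (atMost C L₁ L₂) → Der Φ (atMost D (opp L₂) L₃)
          → Der Φ (atMost (C +ℤ D) L₁ L₃)
  rule2   : ∀ {C D L₁ L₂ L₃} → Der Φ (atLeast C L₁ L₂) → Der Φ (atMost D L₂ L₃)
          → Der Φ (atLeast (C - D) L₁ (opp L₃))
  rule3   : ∀ {C D L₁ L₂} → Der Φ (atMost C L₁ L₁) → Der Φ (atLeast D L₁ L₂)
          → Der Φ (atMost (C - D) L₁ (opp L₂))
  efq     : ∀ {C D L₁ L₂ θ} → Der Φ (atMost C L₁ L₂) → Der Φ (atLeast D L₁ L₂)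
          → C < D → Der Φ θ

_⊢M_ : List N1 → N1 → Set
Φ ⊢M φ = Der Φ (embed φ)

litPred : Lit → Pred
litPred (pos p) = p
litPred (neg p) = p

data OccursIn (p : Pred) : N1 → Set where
  occ₁ : ∀ {N L₁ L₂} → litPred L₁ ≡ p → OccursIn p (atLeast N L₁ L₂)
  occ₂ : ∀ {N L₁ L₂} → litPred L₂ ≡ p → OccursIn p (atLeast N L₁ L₂)
  occ₃ : ∀ {N L₁ L₂} → litPred L₁ ≡ p → OccursIn p (atMost N L₁ L₂)
  occ₄ : ∀ {N L₁ L₂} → litPred L₂ ≡ p → OccursIn p (atMost N L₁ L₂)

PredOf : List N1 → Pred → Set
PredOf Φ p = Σ N1 λ ψ → ψ ∈ Φ × OccursIn p ψ

NumericallyExplicit : List N1 → Set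
NumericallyExplicit Φ =
  Σ ℕ λ C → Σ (Pred → ℕ) λ c → C > 0 ×
    (∀ p → PredOf Φ p →
        c p ≤ C
      × atMost  (c p) (pos p) (pos p) ∈ Φ
      × atLeast (c p) (pos p) (pos p) ∈ Φ
      × atMost  (C Data.Nat.∸ c p) (neg p) (neg p) ∈ Φ
      × atLeast (C Data.Nat.∸ c p) (neg p) (neg p) ∈ Φ)

{-# OPTIONS --safe #-}

-- Φ₀ says that p₀, …, p₃ are pairwise disjoint singletons in a universe of
-- three elements, which is impossible by the pigeonhole principle, so Φ₀
-- entails everything.  But each rule of M only ever combines the counts of
-- two conjunctions of literals, and any two of the four predicates can be
-- realised as disjoint singletons among three elements.  Taking these
-- pairwise counts as a "pseudo-model" validates the axioms and rules of M
-- and every formula of Φ₀, while it gives p₀ ∧ p₁ zero elements; hence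
-- ∃_{≥1} x (p₀ ∧ p₁) is not derivable from Φ₀.

module Submission where

open import Defs
open import Data.Bool using (Bool; true; false; not; _∧_; if_then_else_)
open import Data.Bool.Properties using (∧-idem)
import Data.Bool as Bool
open import Data.Empty using (⊥; ⊥-elim)
open import Data.Fin as Fin using (Fin; zero; suc; toℕ)
open import Data.Fin.Patterns using (0F; 1F; 2F; 3F)
open import Data.Fin.Properties using (<-cmp; toℕ<n)
open import Data.Integer as ℤ using (+_)
import Data.Integer.Properties as ℤP
open import Algebra.Properties.AbelianGroup ℤP.+-0-abelianGroup using (//-rightDividesʳ; xyx⁻¹≈y)
open import Data.List using (List; []; _∷_; _++_; map; concatMap; upTo; allFin; cartesianProduct)
open import Data.List.Membership.Propositional using (_∈_)
open import Data.List.Membership.Propositional.Properties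
  using (∈-++⁺ˡ; ∈-++⁺ʳ; ∈-concat⁺′; ∈-map⁺; ∈-upTo⁺; ∈-allFin; ∈-cartesianProduct⁺)
open import Data.List.Relation.Binary.Subset.Propositional using (_⊆_)
open import Data.List.Relation.Unary.All as All using (All)
open import Data.List.Relation.Unary.Any using (here; there)
open import Data.Nat as ℕ using (ℕ; _+_; _≤_; _<_; _⊔_; z≤n; s≤s)
open import Data.Nat.Properties using (m≤m⊔n; m≤n⊔m; ≤-<-trans)
open import Data.Product using (Σ; _×_; _,_; proj₁; proj₂)
open import Function using (_∘_)
open import Function.Definitions using (Injective)
open import Relation.Binary using (tri<; tri≈; tri>)
open import Relation.Binary.PropositionalEquality
open import Relation.Nullary using (¬_; Dec; does)
open import Relation.Nullary.Decidable using (map′; from-yes; from-no)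
open import Relation.Unary using (Decidable)

i≤j+k⇒i-k≤j : ∀ {i} j k → i ℤ.≤ j ℤ.+ k → i ℤ.- k ℤ.≤ j
i≤j+k⇒i-k≤j j k i≤j+k =
  ℤP.≤-trans (ℤP.+-monoˡ-≤ (ℤ.- k) i≤j+k) (ℤP.≤-reflexive (//-rightDividesʳ k j))

k+i≤j⇒i≤j-k : ∀ {i j} k → k ℤ.+ i ℤ.≤ j → i ℤ.≤ j ℤ.- k
k+i≤j⇒i≤j-k {i} k k+i≤j =
  ℤP.≤-trans (ℤP.≤-reflexive (sym (xyx⁻¹≈y k i))) (ℤP.+-monoˡ-≤ (ℤ.- k) k+i≤j)

opp-involutive : ∀ L → opp (opp L) ≡ L
opp-involutive (pos _) = refl
opp-involutive (neg _) = refl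

-- Sizes of conjunctions of two literals, subject only to the laws that the
-- rules of M rely on.
record PseudoModel (K : Set) (compl : K → K) : Set where
  field
    count       : K → K → ℕ
    count-sym   : ∀ a b → count a b ≡ count b a
    count-compl : ∀ a → count a (compl a) ≡ 0
    count-cut   : ∀ a b c → count a c ≤ count a b + count (compl b) c
    count-split : ∀ a b → count a b + count a (compl b) ≤ count a a

comap : ∀ {K K′ compl compl′} (f : K′ → K) → (∀ a → f (compl′ a) ≡ compl (f a)) →
        PseudoModel K compl → PseudoModel K′ compl′
comap {compl′ = compl′} f f-compl M = record
  { count       = λ a b → count (f a) (f b)
  ; count-sym   = λ a b → count-sym (f a) (f b)
  ; count-compl = count-compl′
  ; count-cut   = count-cut′
  ; count-split = count-split′
  }
  where
  open PseudoModel M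

  count-compl′ : ∀ a → count (f a) (f (compl′ a)) ≡ 0
  count-compl′ a rewrite f-compl a = count-compl (f a)

  count-cut′ : ∀ a b c → count (f a) (f c) ≤ count (f a) (f b) + count (f (compl′ b)) (f c)
  count-cut′ a b c rewrite f-compl b = count-cut (f a) (f b) (f c)

  count-split′ : ∀ a b → count (f a) (f b) + count (f a) (f (compl′ b)) ≤ count (f a) (f a)
  count-split′ a b rewrite f-compl b = count-split (f a) (f b)

module Soundness (M : PseudoModel Lit opp) where
  open PseudoModel M

  Holds : ZForm → Set
  Holds (atLeast C L₁ L₂) = C ℤ.≤ + count L₁ L₂
  Holds (atMost  C L₁ L₂) = + count L₁ L₂ ℤ.≤ C

  holds? : ∀ θ → Dec (Holds θ)
  holds? (atLeast C L₁ L₂) = C ℤ.≤? + count L₁ L₂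
  holds? (atMost  C L₁ L₂) = + count L₁ L₂ ℤ.≤? C

  count-cutʳ : ∀ L₁ L₂ L₃ → count L₁ L₂ ≤ count L₁ (opp L₃) + count L₂ L₃
  count-cutʳ L₁ L₂ L₃ with count-cut L₁ (opp L₃) L₂
  ... | cut rewrite opp-involutive L₃ | count-sym L₃ L₂ = cut

  sound : ∀ {Φ} → All (Holds ∘ embed) Φ → ∀ {θ} → Der Φ θ → Holds θ
  sound Φ-holds (premise φ∈Φ) = All.lookup Φ-holds φ∈Φ
  sound Φ-holds (ax≥0 L₁ L₂) = ℤ.+≤+ z≤n
  sound Φ-holds (ax≤opp C L) rewrite count-compl L = ℤ.+≤+ z≤n
  sound Φ-holds (swap≥ {L₁ = L₁} {L₂} d) rewrite count-sym L₂ L₁ = sound Φ-holds d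
  sound Φ-holds (swap≤ {L₁ = L₁} {L₂} d) rewrite count-sym L₂ L₁ = sound Φ-holds d
  sound Φ-holds (rule1 {C} {D} {L₁} {L₂} {L₃} d e) = begin
    + count L₁ L₃                                  ≤⟨ ℤ.+≤+ (count-cut L₁ L₂ L₃) ⟩
    + (count L₁ L₂ + count (opp L₂) L₃)            ≡⟨ ℤP.pos-+ (count L₁ L₂) _ ⟩
    + count L₁ L₂ ℤ.+ + count (opp L₂) L₃          ≤⟨ ℤP.+-mono-≤ (sound Φ-holds d) (sound Φ-holds e) ⟩
    C ℤ.+ D                                        ∎
    where open ℤP.≤-Reasoning
  sound Φ-holds (rule2 {C} {D} {L₁} {L₂} {L₃} d e) = i≤j+k⇒i-k≤j _ D (begin
    C                                              ≤⟨ sound Φ-holds d ⟩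
    + count L₁ L₂                                  ≤⟨ ℤ.+≤+ (count-cutʳ L₁ L₂ L₃) ⟩
    + (count L₁ (opp L₃) + count L₂ L₃)            ≡⟨ ℤP.pos-+ (count L₁ (opp L₃)) _ ⟩
    + count L₁ (opp L₃) ℤ.+ + count L₂ L₃          ≤⟨ ℤP.+-monoʳ-≤ (+ count L₁ (opp L₃)) (sound Φ-holds e) ⟩
    + count L₁ (opp L₃) ℤ.+ D                      ∎)
    where open ℤP.≤-Reasoning
  sound Φ-holds (rule3 {C} {D} {L₁} {L₂} d e) = k+i≤j⇒i≤j-k D (begin
    D ℤ.+ + count L₁ (opp L₂)                      ≤⟨ ℤP.+-monoˡ-≤ (+ count L₁ (opp L₂)) (sound Φ-holds e) ⟩
    + count L₁ L₂ ℤ.+ + count L₁ (opp L₂)          ≡⟨ ℤP.pos-+ (count L₁ L₂) _ ⟨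
    + (count L₁ L₂ + count L₁ (opp L₂))            ≤⟨ ℤ.+≤+ (count-split L₁ L₂) ⟩
    + count L₁ L₁                                  ≤⟨ sound Φ-holds d ⟩
    C                                              ∎)
    where open ℤP.≤-Reasoning
  sound Φ-holds (efq d e C<D) =
    ⊥-elim (ℤP.<⇒≱ C<D (ℤP.≤-trans (sound Φ-holds e) (sound Φ-holds d)))

  unprovable : ∀ {Φ φ} → All (Holds ∘ embed) Φ → ¬ Holds (embed φ) → ¬ (Φ ⊢M φ)
  unprovable Φ-holds ¬φ-holds d = ¬φ-holds (sound Φ-holds d)

module _ {A : Set} (I : Interp A) where

  _holdsAt_ : Lit → A → Set
  L holdsAt a = litVal I L a ≡ true

  witness : ∀ {L} → Sat I (atLeast 1 L L) → Σ A (L holdsAt_)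
  witness (f , _ , f∈L) = f zero , trans (sym (∧-idem _)) (f∈L zero)

  disjoint : ∀ {L₁ L₂ a} → Sat I (atMost 0 L₁ L₂) → L₁ holdsAt a → L₂ holdsAt a → ⊥
  disjoint {a = a} L₁∩L₂≤0 a∈L₁ a∈L₂ =
    L₁∩L₂≤0 (λ _ → a) (λ { {zero} {zero} _ → refl }) (λ _ → cong₂ _∧_ a∈L₁ a∈L₂)

  outside : ∀ {p L a} → Sat I (atMost 0 (pos p) L) → L holdsAt a → neg p holdsAt a
  outside {p} {L} {a} p∩L≤0 a∈L with I p a in a∈p
  ... | true  = ⊥-elim (disjoint {pos p} {L} p∩L≤0 a∈p a∈L)
  ... | false = refl

  distinctWitnesses : ∀ {n} (L : Fin n → Lit) →
    (∀ k → Sat I (atLeast 1 (L k) (L k))) →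
    (∀ {j k} → j Fin.< k → Sat I (atMost 0 (L j) (L k))) →
    Σ (Fin n → A) λ f → Injective _≡_ _≡_ f × (∀ k → L k holdsAt f k)
  distinctWitnesses L nonempty disjointL = w , w-injective , w∈L
    where
    w : Fin _ → A
    w k = proj₁ (witness {L k} (nonempty k))

    w∈L : ∀ k → L k holdsAt w k
    w∈L k = proj₂ (witness {L k} (nonempty k))

    w-distinct : ∀ {j k} → j Fin.< k → w j ≢ w k
    w-distinct {j} {k} j<k wj≡wk =
      disjoint {L j} {L k} (disjointL j<k) (w∈L j) (subst (L k holdsAt_) (sym wj≡wk) (w∈L k))

    w-injective : Injective _≡_ _≡_ w
    w-injective {j} {k} wj≡wk with <-cmp j k
    ... | tri< j<k _ _ = ⊥-elim (w-distinct j<k wj≡wk)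
    ... | tri≈ _ j≡k _ = j≡k
    ... | tri> _ _ k<j = ⊥-elim (w-distinct k<j (sym wj≡wk))

  pigeonhole : ∀ {n p} (L : Fin (ℕ.suc n) → Lit) →
    Sat I (atMost n (neg p) (neg p)) →
    (∀ k → Sat I (atLeast 1 (L k) (L k))) →
    (∀ {j k} → j Fin.< k → Sat I (atMost 0 (L j) (L k))) →
    (∀ k → Sat I (atMost 0 (pos p) (L k))) → ⊥
  pigeonhole L few nonempty disjointL disjointP with distinctWitnesses L nonempty disjointL
  ... | f , f-injective , f∈L = few f f-injective λ k →
    let f∉p = outside {L = L k} (disjointP k) (f∈L k) in cong₂ _∧_ f∉p f∉p

singletonOfThree : Pred → List N1
singletonOfThree p =
  atMost 1 (pos p) (pos p) ∷ atLeast 1 (pos p) (pos p) ∷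
  atMost 2 (neg p) (neg p) ∷ atLeast 2 (neg p) (neg p) ∷ []

disjointFromSmaller : Pred → List N1
disjointFromSmaller q = map (λ p → atMost 0 (pos p) (pos q)) (upTo q)

Φ₀ : List N1
Φ₀ = concatMap singletonOfThree (upTo 4) ++ concatMap disjointFromSmaller (upTo 4)

φ₀ : N1
φ₀ = atLeast 1 (pos 0) (pos 1)

singletonOfThree⊆Φ₀ : ∀ {p} → p < 4 → singletonOfThree p ⊆ Φ₀
singletonOfThree⊆Φ₀ p<4 ψ∈ = ∈-++⁺ˡ (∈-concat⁺′ ψ∈ (∈-map⁺ singletonOfThree (∈-upTo⁺ p<4)))

disjoint∈Φ₀ : ∀ {p q} → p < q → q < 4 → atMost 0 (pos p) (pos q) ∈ Φ₀
disjoint∈Φ₀ p<q q<4 = ∈-++⁺ʳ (concatMap singletonOfThree (upTo 4))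
  (∈-concat⁺′ (∈-map⁺ _ (∈-upTo⁺ p<q)) (∈-map⁺ disjointFromSmaller (∈-upTo⁺ q<4)))

maxPred : N1 → Pred
maxPred (atLeast _ L₁ L₂) = litPred L₁ ⊔ litPred L₂
maxPred (atMost  _ L₁ L₂) = litPred L₁ ⊔ litPred L₂

occurs⇒≤maxPred : ∀ {p ψ} → OccursIn p ψ → p ≤ maxPred ψ
occurs⇒≤maxPred (occ₁ refl) = m≤m⊔n _ _
occurs⇒≤maxPred (occ₂ refl) = m≤n⊔m _ _
occurs⇒≤maxPred (occ₃ refl) = m≤m⊔n _ _
occurs⇒≤maxPred (occ₄ refl) = m≤n⊔m _ _

predOfΦ₀⇒<4 : ∀ {p} → PredOf Φ₀ p → p < 4
predOfΦ₀⇒<4 (ψ , ψ∈Φ₀ , p∈ψ) =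
  ≤-<-trans (occurs⇒≤maxPred p∈ψ) (All.lookup maxPred<4 ψ∈Φ₀)
  where
  maxPred<4 : All (λ ψ → maxPred ψ < 4) Φ₀
  maxPred<4 = from-yes (All.all? (λ ψ → maxPred ψ ℕ.<? 4) Φ₀)

Φ₀-numericallyExplicit : NumericallyExplicit Φ₀
Φ₀-numericallyExplicit = 3 , (λ _ → 1) , s≤s z≤n , λ p p∈Φ₀ →
  let ⊆Φ₀ = singletonOfThree⊆Φ₀ (predOfΦ₀⇒<4 p∈Φ₀) in
  s≤s z≤n , ⊆Φ₀ (here refl) , ⊆Φ₀ (there (here refl)) ,
  ⊆Φ₀ (there (there (here refl))) , ⊆Φ₀ (there (there (there (here refl))))

Φ₀-unsatisfiable : ∀ {A} (I : Interp A) → ¬ (∀ {ψ} → ψ ∈ Φ₀ → Sat I ψ)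
Φ₀-unsatisfiable I sat =
  pigeonhole I L
    (sat (singletonOfThree⊆Φ₀ (s≤s z≤n) (there (there (here refl)))))
    (λ k → sat (singletonOfThree⊆Φ₀ (suc<4 k) (there (here refl))))
    (λ {j} {k} j<k → sat (disjoint∈Φ₀ (s≤s j<k) (suc<4 k)))
    (λ k → sat (disjoint∈Φ₀ (s≤s z≤n) (suc<4 k)))
  where
  L : Fin 3 → Lit
  L k = pos (ℕ.suc (toℕ k))

  suc<4 : ∀ (k : Fin 3) → ℕ.suc (toℕ k) < 4
  suc<4 k = s≤s (toℕ<n k)

data Atom : Set where
  named : Fin 4 → Atom
  spare : Atom

Class : Set
Class = Atom × Bool

atom : Pred → Atom
atom 0 = named 0F
atom 1 = named 1F
atom 2 = named 2F
atom 3 = named 3F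
atom _ = spare

class : Lit → Class
class (pos p) = atom p , true
class (neg p) = atom p , false

complement : Class → Class
complement (a , s) = a , not s

class-opp : ∀ L → class (opp L) ≡ complement (class L)
class-opp (pos _) = refl
class-opp (neg _) = refl

size : Class → ℕ
size (named _ , true)  = 1
size (named _ , false) = 2
size (spare   , true)  = 0
size (spare   , false) = 3

-- count a b is the size of a ∩ b in a universe of three elements in which
-- the (at most two) named predicates of a and b are disjoint singletons and
-- spare predicates are empty.
count : Class → Class → ℕ
count (spare , true)  b = 0
count (spare , false) b = size b
count a (spare , true)  = 0
count a (spare , false) = size a
count a@(named i , s) (named j , t) =
  if does (i Fin.≟ j)
  then (if does (s Bool.≟ t) then size a else 0)
  else (if s ∧ t then 0 else 1)

classes : List Class
classes = cartesianProduct (spare ∷ map named (allFin 4)) (true ∷ false ∷ [])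

∈-classes : ∀ a → a ∈ classes
∈-classes (a , s) = ∈-cartesianProduct⁺ (∈-atoms a) (∈-signs s)
  where
  ∈-atoms : ∀ a → a ∈ spare ∷ map named (allFin 4)
  ∈-atoms (named i) = there (∈-map⁺ named (∈-allFin i))
  ∈-atoms spare     = here refl

  ∈-signs : ∀ s → s ∈ true ∷ false ∷ []
  ∈-signs true  = here refl
  ∈-signs false = there (here refl)

∀-class? : {P : Class → Set} → Decidable P → Dec (∀ a → P a)
∀-class? P? = map′ (λ all a → All.lookup all (∈-classes a)) (λ ∀P → All.tabulate λ {a} _ → ∀P a)
  (All.all? P? classes)

class-model : PseudoModel Class complement
class-model = record
  { count       = count
  ; count-sym   = from-yes (∀-class? λ a → ∀-class? λ b → count a b ℕ.≟ count b a)
  ; count-compl = from-yes (∀-class? λ a → count a (complement a) ℕ.≟ 0)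
  ; count-cut   = from-yes (∀-class? λ a → ∀-class? λ b → ∀-class? λ c →
                    count a c ℕ.≤? count a b + count (complement b) c)
  ; count-split = from-yes (∀-class? λ a → ∀-class? λ b →
                    count a b + count a (complement b) ℕ.≤? count a a)
  }

Φ₀⊬φ₀ : ¬ (Φ₀ ⊢M φ₀)
Φ₀⊬φ₀ = unprovable (from-yes (All.all? (holds? ∘ embed) Φ₀)) (from-no (holds? (embed φ₀)))
  where open Soundness (comap class class-opp class-model)

theorem16 : Σ (List N1) λ Φ → Σ N1 λ φ →
    NumericallyExplicit Φ × (Φ ⊨ φ) × ¬ (Φ ⊢M φ)
theorem16 =
  Φ₀ , φ₀ , Φ₀-numericallyExplicit , (λ A I sat → ⊥-elim (Φ₀-unsatisfiable I sat)) , Φ₀⊬φ₀
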